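{- For positive integers $c$ and $r$, let $(c^r)$ denote the rectangular partition with $r$ rows each of length $c$. Then $$ \mathrm{SG}(\mathrm{LCTR}((c^r))) = \begin{cases} 0 & \text{if } c > 1 \mbox{ and } r > 1 \mbox{ and } c+r \mbox{ is even} \\ 2 & \text{if } c \leq 2 \mbox{ or } r \leq 2, \mbox{ and } c + r \mbox{ is odd}\\ 1 & \text{otherwise} \end{cases}.$$
   Context: A partition $\lambda=(\lambda_1,\dots,\lambda_r)$ with $\lambda_1\ge\dots\ge\lambda_r>0$ is identified with its Young diagram. For integers $i,j\ge 0$, $\lambda[i,j]$ denotes the subpartition obtained by deleting the top $i$ rows and the leftmost $j$ columns (the empty partition $()$ if nothing remains). In the impartial game LCTR played on $\lambda$, a move replaces $\lambda$ by $\lambda[1,0]$ (remove the top row) or by $\lambda[0,1]$ (remove the left column); the empty partition $()$ is the terminal position. The game is under normal play and $\mathrm{SG}$ denotes the Sprague-Grundy value, $\mathrm{SG}(A)=\mathrm{mex}\{\mathrm{SG}(B): A\to B\}$. -}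

module Defs where

open import Data.Nat using (ℕ; zero; suc; _+_; _∸_; _≡ᵇ_)
open import Data.Bool using (Bool; true; false; if_then_else_; _∨_)
open import Data.List using (List; []; _∷_; map; filter; length; replicate)
open import Data.Nat.ListAction using (sum)
open import Data.Bool.ListAction using (any)
open import Relation.Nullary.Decidable using (¬?)
open import Data.Nat.Properties using (_≟_)

-- A partition is a weakly decreasing list of positive row lengths
-- (top row first). The empty list is the empty partition ().
Partition : Set
Partition = List ℕ

delTopRow : Partition → Partition
delTopRow []       = []
delTopRow (_ ∷ xs) = xs

delLeftCol : Partition → Partition
delLeftCol xs = filter (λ n → ¬? (n ≟ 0)) (map (λ n → n ∸ 1) xs)

size : Partition → ℕ
size = sum

memb : ℕ → List ℕ → Bool
memb n = any (λ m → n ≡ᵇ m)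

mexFrom : ℕ → ℕ → List ℕ → ℕ
mexFrom zero    k _  = k
mexFrom (suc f) k xs = if memb k xs then mexFrom f (suc k) xs else k

mex : List ℕ → ℕ
mex xs = mexFrom (suc (length xs)) 0 xs

-- Sprague–Grundy value of LCTR, computed with fuel; with fuel ≥ size λ
-- this is the true SG value (moves strictly decrease size; () is terminal).
sgFuel : ℕ → Partition → ℕ
sgFuel _       []       = 0
sgFuel zero    (_ ∷ _)  = 0
sgFuel (suc f) (x ∷ xs) =
  mex (sgFuel f (delTopRow (x ∷ xs)) ∷ sgFuel f (delLeftCol (x ∷ xs)) ∷ [])

SG-LCTR : Partition → ℕ
SG-LCTR p = sgFuel (size p) p

rect : ℕ → ℕ → Partition
rect c r = replicate r c

-- Removing the top row of (c^r) gives (c^(r-1)) and removing the left column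
-- gives ((c-1)^r), so the SG values of rectangles obey
-- SG(c^r) = mex {SG(c^(r-1)), SG((c-1)^r)}, with value 0 once a side is 0.
-- The claimed closed form, which depends only on the parity of c + r and on
-- whether a side is 1 or at most 2, satisfies this recurrence; this is a
-- finite case check on c, r ∈ {1, 2, 3, ≥ 4} and their parities.
module Submission where

open import Defs
open import Data.Nat using (ℕ; zero; suc; _+_; _<_; _≤_; _>_; z≤n; s≤s; _≤?_; _≤ᵇ_; _≡ᵇ_)
open import Data.Nat.Properties using (_≟_; ≤-refl; ≤-trans; +-monoʳ-≤; n≤1+n; m≤n+m; >⇒≢)
open import Data.Nat.Divisibility using (_∣_; divides; ∣-refl; ∣1⇒≡1; ∣m∣n⇒∣m+n; ∣m+n∣m⇒∣n)
open import Data.Bool using (Bool; true; false; not; _xor_; _∨_; if_then_else_)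
open import Data.Bool.Properties using (∨-zeroʳ; not-involutive; not-distribˡ-xor)
open import Data.Product using (_×_; _,_)
open import Data.Sum using (_⊎_; inj₁; inj₂)
open import Data.Empty using (⊥-elim)
open import Data.List using ([]; _∷_)
open import Relation.Nullary using (¬_)
open import Relation.Nullary.Decidable using (dec-true; dec-false)
open import Relation.Binary.PropositionalEquality using (_≡_; refl; sym; trans; cong; cong₂; module ≡-Reasoning)

odd : ℕ → Bool
odd zero    = false
odd (suc n) = not (odd n)

odd-+ : ∀ m n → odd (m + n) ≡ odd m xor odd n
odd-+ zero    n = refl
odd-+ (suc m) n rewrite odd-+ m n = not-distribˡ-xor (odd m) (odd n)

parity : ∀ n → (odd n ≡ false × 2 ∣ n) ⊎ (odd n ≡ true × ¬ 2 ∣ n)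
parity 0 = inj₁ (refl , divides 0 refl)
parity 1 = inj₂ (refl , λ 2∣1 → 2≢1 (∣1⇒≡1 2∣1))
  where
  2≢1 : ¬ 2 ≡ 1
  2≢1 ()
parity (suc (suc n)) with parity n
... | inj₁ (even-n , 2∣n) = inj₁ (trans (not-involutive _) even-n , ∣m∣n⇒∣m+n (∣-refl {2}) 2∣n)
... | inj₂ (odd-n , 2∤n) = inj₂ (trans (not-involutive _) odd-n , λ 2∣ → 2∤n (∣m+n∣m⇒∣n 2∣ (∣-refl {2})))

2∣+⇒xor≡false : ∀ m n → 2 ∣ m + n → odd m xor odd n ≡ false
2∣+⇒xor≡false m n 2∣ with parity (m + n)
... | inj₁ (even-n , _) = trans (sym (odd-+ m n)) even-n
... | inj₂ (_ , 2∤) = ⊥-elim (2∤ 2∣)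

2∤+⇒xor≡true : ∀ m n → ¬ 2 ∣ m + n → odd m xor odd n ≡ true
2∤+⇒xor≡true m n 2∤ with parity (m + n)
... | inj₁ (_ , 2∣) = ⊥-elim (2∤ 2∣)
... | inj₂ (odd-n , _) = trans (sym (odd-+ m n)) odd-n

≤ᵇ≡true : ∀ {m n} → m ≤ n → (m ≤ᵇ n) ≡ true
≤ᵇ≡true = dec-true (_ ≤? _)

≤ᵇ≡false : ∀ {m n} → ¬ m ≤ n → (m ≤ᵇ n) ≡ false
≤ᵇ≡false = dec-false (_ ≤? _)

≡ᵇ≡true : ∀ {m n} → m ≡ n → (m ≡ᵇ n) ≡ true
≡ᵇ≡true = dec-true (_ ≟ _)

≡ᵇ≡false : ∀ {m n} → ¬ m ≡ n → (m ≡ᵇ n) ≡ false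
≡ᵇ≡false = dec-false (_ ≟ _)

-- The closed form; only meaningful for positive c and r.
grundy : ℕ → ℕ → ℕ
grundy c r =
  if odd c xor odd r
  then (if (c ≤ᵇ 2) ∨ (r ≤ᵇ 2) then 2 else 1)
  else (if (c ≡ᵇ 1) ∨ (r ≡ᵇ 1) then 1 else 0)

rectSG : ℕ → ℕ → ℕ
rectSG zero    r       = 0
rectSG (suc c) zero    = 0
rectSG (suc c) (suc r) = grundy (suc c) (suc r)

rectSG-mex : ∀ c r → rectSG (suc c) (suc r) ≡ mex (rectSG (suc c) r ∷ rectSG c (suc r) ∷ [])
rectSG-mex 0 0 = refl
rectSG-mex 0 1 = refl
rectSG-mex 0 2 = refl
rectSG-mex 0 (suc (suc (suc r))) with odd r
... | true  = refl
... | false = refl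
rectSG-mex 1 0 = refl
rectSG-mex 1 1 = refl
rectSG-mex 1 2 = refl
rectSG-mex 1 (suc (suc (suc r))) with odd r
... | true  = refl
... | false = refl
rectSG-mex 2 0 = refl
rectSG-mex 2 1 = refl
rectSG-mex 2 2 = refl
rectSG-mex 2 (suc (suc (suc r))) with odd r
... | true  = refl
... | false = refl
rectSG-mex (suc (suc (suc c))) 0 with odd c
... | true  = refl
... | false = refl
rectSG-mex (suc (suc (suc c))) 1 with odd c
... | true  = refl
... | false = refl
rectSG-mex (suc (suc (suc c))) 2 with odd c
... | true  = refl
... | false = refl
rectSG-mex (suc (suc (suc c))) (suc (suc (suc r))) with odd c | odd r
... | true  | true  = refl
... | true  | false = refl
... | false | true  = refl
... | false | false = refl

delLeftCol-rect-suc : ∀ c r → delLeftCol (rect (suc (suc c)) r) ≡ rect (suc c) r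
delLeftCol-rect-suc c zero    = refl
delLeftCol-rect-suc c (suc r) = cong (suc c ∷_) (delLeftCol-rect-suc c r)

delLeftCol-rect-1 : ∀ r → delLeftCol (rect 1 r) ≡ []
delLeftCol-rect-1 zero    = refl
delLeftCol-rect-1 (suc r) = delLeftCol-rect-1 r

size-rect-monoˡ : ∀ c r → size (rect c r) ≤ size (rect (suc c) r)
size-rect-monoˡ c zero    = z≤n
size-rect-monoˡ c (suc r) = ≤-trans (+-monoʳ-≤ c (size-rect-monoˡ c r)) (n≤1+n _)

sgFuel-rect : ∀ f c r → size (rect (suc c) r) ≤ f → sgFuel f (rect (suc c) r) ≡ rectSG (suc c) r
sgFuel-rect f       c zero    _       = refl
sgFuel-rect (suc f) c (suc r) (s≤s h) = begin
    mex (sgFuel f (rect (suc c) r) ∷ sgFuel f (delLeftCol (rect (suc c) (suc r))) ∷ [])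
  ≡⟨ cong₂ (λ a b → mex (a ∷ b ∷ [])) (sgFuel-rect f c r (≤-trans (m≤n+m _ c) h)) (leftColumnRemoved c h) ⟩
    mex (rectSG (suc c) r ∷ rectSG c (suc r) ∷ [])
  ≡⟨ sym (rectSG-mex c r) ⟩
    rectSG (suc c) (suc r)
  ∎
  where
  open ≡-Reasoning
  leftColumnRemoved : ∀ c → c + size (rect (suc c) r) ≤ f →
                      sgFuel f (delLeftCol (rect (suc c) (suc r))) ≡ rectSG c (suc r)
  leftColumnRemoved zero    _ rewrite delLeftCol-rect-1 r = refl
  leftColumnRemoved (suc c) h rewrite delLeftCol-rect-suc c (suc r) =
    sgFuel-rect f c (suc r) (≤-trans (s≤s (+-monoʳ-≤ c (size-rect-monoˡ (suc c) r))) h)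

SG-LCTR-rect : ∀ c r → SG-LCTR (rect (suc c) (suc r)) ≡ grundy (suc c) (suc r)
SG-LCTR-rect c r = sgFuel-rect _ c (suc r) ≤-refl

grundy-even-large : ∀ c r → c > 1 → r > 1 → 2 ∣ c + r → grundy c r ≡ 0
grundy-even-large c r c>1 r>1 2∣
  rewrite 2∣+⇒xor≡false c r 2∣ | ≡ᵇ≡false (>⇒≢ c>1) | ≡ᵇ≡false (>⇒≢ r>1) = refl

grundy-odd-small : ∀ c r → c ≤ 2 ⊎ r ≤ 2 → ¬ 2 ∣ c + r → grundy c r ≡ 2
grundy-odd-small c r (inj₁ c≤2) 2∤ rewrite 2∤+⇒xor≡true c r 2∤ | ≤ᵇ≡true c≤2 = refl
grundy-odd-small c r (inj₂ r≤2) 2∤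
  rewrite 2∤+⇒xor≡true c r 2∤ | ≤ᵇ≡true r≤2 | ∨-zeroʳ (c ≤ᵇ 2) = refl

side≡1 : ∀ {c r} → 0 < c → 0 < r → ¬ (c > 1 × r > 1) → c ≡ 1 ⊎ r ≡ 1
side≡1 {suc zero}    {r}           _ _ _ = inj₁ refl
side≡1 {suc (suc c)} {suc zero}    _ _ _ = inj₂ refl
side≡1 {suc (suc c)} {suc (suc r)} _ _ ¬large = ⊥-elim (¬large (s≤s (s≤s z≤n) , s≤s (s≤s z≤n)))

grundy-otherwise : ∀ c r → 0 < c → 0 < r →
  ¬ (c > 1 × r > 1 × 2 ∣ c + r) → ¬ ((c ≤ 2 ⊎ r ≤ 2) × ¬ 2 ∣ c + r) → grundy c r ≡ 1
grundy-otherwise c r c>0 r>0 ¬case0 ¬case2 with parity (c + r)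
... | inj₁ (_ , 2∣) rewrite 2∣+⇒xor≡false c r 2∣
  with side≡1 c>0 r>0 (λ (c>1 , r>1) → ¬case0 (c>1 , r>1 , 2∣))
...   | inj₁ c≡1 rewrite ≡ᵇ≡true c≡1 = refl
...   | inj₂ r≡1 rewrite ≡ᵇ≡true r≡1 | ∨-zeroʳ (c ≡ᵇ 1) = refl
grundy-otherwise c r _ _ _ ¬case2 | inj₂ (_ , 2∤)
  rewrite 2∤+⇒xor≡true c r 2∤
        | ≤ᵇ≡false (λ c≤2 → ¬case2 (inj₁ c≤2 , 2∤))
        | ≤ᵇ≡false (λ r≤2 → ¬case2 (inj₂ r≤2 , 2∤)) = refl

lemma5p6 : (c r : ℕ) → 0 < c → 0 < r →
    ((c > 1 × r > 1 × 2 ∣ (c + r)) → SG-LCTR (rect c r) ≡ 0) ×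
    (((c ≤ 2 ⊎ r ≤ 2) × ¬ (2 ∣ (c + r))) → SG-LCTR (rect c r) ≡ 2) ×
    (¬ (c > 1 × r > 1 × 2 ∣ (c + r)) → ¬ ((c ≤ 2 ⊎ r ≤ 2) × ¬ (2 ∣ (c + r))) →
      SG-LCTR (rect c r) ≡ 1)
lemma5p6 (suc c) (suc r) c>0 r>0 =
  (λ (c>1 , r>1 , 2∣) → trans sg (grundy-even-large _ _ c>1 r>1 2∣)) ,
  (λ (small , 2∤) → trans sg (grundy-odd-small _ _ small 2∤)) ,
  (λ ¬case0 ¬case2 → trans sg (grundy-otherwise _ _ c>0 r>0 ¬case0 ¬case2))
  where
  sg : SG-LCTR (rect (suc c) (suc r)) ≡ grundy (suc c) (suc r)
  sg = SG-LCTR-rect c r
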